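{- Let $a,n,p\in\mathbb{Z}$ with $a\ge 1$, $n\ge 2$ and $p$ a prime. Then $f_{n,a,p}(x)=x^n-ax^{n-1}-p$ is irreducible over $\mathbb{Q}$ except when $n$ is even and $p=a+1$. -}

module Defs where

open import Data.Nat as ℕ using (ℕ; zero; suc; _∸_)
open import Data.Rational as ℚ using (ℚ; 0ℚ; 1ℚ)
open import Data.Integer using (+_)
open import Data.Integer using (+_)
open import Data.List using (List; []; _∷_; map)
open import Data.Product using (Σ; ∃; _×_)
open import Data.Sum using (_⊎_)
open import Relation.Binary.PropositionalEquality using (_≡_)
open import Relation.Nullary using (¬_)

-- Univariate polynomials over ℚ, as coefficient lists, lowest degree first.
-- Trailing zero coefficients are allowed; equality of polynomials is
-- coefficientwise (_≈ₚ_ below), so e.g. [] and (0ℚ ∷ []) represent the same polynomial.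
Poly : Set
Poly = List ℚ

coeff : Poly → ℕ → ℚ
coeff []       _       = 0ℚ
coeff (c ∷ cs) zero    = c
coeff (c ∷ cs) (suc i) = coeff cs i

_≈ₚ_ : Poly → Poly → Set
f ≈ₚ g = ∀ i → coeff f i ≡ coeff g i

infix 4 _≈ₚ_
infixl 6 _+ₚ_ _-ₚ_
infixl 7 _*ₚ_
infixr 8 _^ₚ_

const : ℚ → Poly
const c = c ∷ []

X : Poly
X = 0ℚ ∷ 1ℚ ∷ []

_+ₚ_ : Poly → Poly → Poly
[]       +ₚ g        = g
(c ∷ cs) +ₚ []       = c ∷ cs
(c ∷ cs) +ₚ (d ∷ ds) = (c ℚ.+ d) ∷ (cs +ₚ ds)

-ₚ_ : Poly → Poly
-ₚ f = map ℚ.-_ f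

_-ₚ_ : Poly → Poly → Poly
f -ₚ g = f +ₚ (-ₚ g)

_*ₚ_ : Poly → Poly → Poly
[]       *ₚ g = []
(c ∷ cs) *ₚ g = map (c ℚ.*_) g +ₚ (0ℚ ∷ (cs *ₚ g))

_^ₚ_ : Poly → ℕ → Poly
f ^ₚ zero  = const 1ℚ
f ^ₚ suc k = f *ₚ (f ^ₚ k)

IsUnit : Poly → Set
IsUnit f = ∃ λ g → f *ₚ g ≈ₚ const 1ℚ

Irreducible : Poly → Set
Irreducible f = ¬ IsUnit f × (∀ g h → f ≈ₚ g *ₚ h → IsUnit g ⊎ IsUnit h)

fPoly : ℕ → ℕ → ℕ → Poly
fPoly n a p = X ^ₚ n -ₚ const ((+ a ℚ./ 1)) *ₚ X ^ₚ (n ∸ 1) -ₚ const ((+ p ℚ./ 1))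

{-# OPTIONS --safe #-}
module Submission where

-- Clearing denominators and dividing each prime of the common denominator into one of the two factors
-- (Gauss's lemma) turns a factorisation f = g h over ℚ into one over ℤ with the same zero coefficients.
-- Over ℤ, f ≡ xⁿ⁻¹(x − a) (mod p) and p ∥ f(0), so p divides the constant term of at most one factor, say
-- p ∤ H(0). Then the first coefficient of G not divisible by p survives modulo p in G H = f, so it sits at
-- an index ≥ n − 1 and deg H ≤ 1. A linear factor gives an integer root u with p = uⁿ⁻¹(u − a); then
-- |u| divides p, and |u| = 1 or |u| = p leaves only n even and p = a + 1. Conversely, in that case
-- f(−1) = 0, and f = (1 + x) q exhibits two non-units.

open import Algebra.Bundles using (CommutativeSemigroup; CommutativeRing)
open import Algebra.Core using (Op₂)
open import Algebra.Structures using (IsCommutativeSemiringWithoutOne; IsCommutativeSemiring; IsCommutativeRing)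
open import Data.Empty using (⊥; ⊥-elim)
open import Data.Nat as ℕ using (ℕ; zero; suc; _∸_; _≤_; _<_; z≤n; s≤s)
import Data.Nat.Properties as ℕP
open import Data.Product using (∃; ∃₂; _×_; _,_; proj₁; proj₂)
open import Data.Sum as Sum using (_⊎_; inj₁; inj₂; [_,_]′)
open import Function using (_∘_; id; _⇔_; mk⇔; Equivalence)
open import Relation.Binary.Definitions using (tri<; tri≈; tri>)
open import Relation.Binary.PropositionalEquality
open import Relation.Nullary using (¬_; Dec; yes; no; contradiction)

module Convolution {A : Set} {plus times : Op₂ A} {0# : A}
                   (isCommutativeSemiringWithoutOne : IsCommutativeSemiringWithoutOne _≡_ plus times 0#) where

  private
    infixl 6 _+_
    infixl 7 _*_
    _+_ _*_ : Op₂ A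
    _+_ = plus
    _*_ = times

  open IsCommutativeSemiringWithoutOne isCommutativeSemiringWithoutOne
    using (+-identityˡ; +-identityʳ; +-comm; +-isCommutativeSemigroup; *-assoc; *-comm; zeroˡ; zeroʳ; distribˡ)
  open ≡-Reasoning

  private
    +-commutativeSemigroup : CommutativeSemigroup _ _
    +-commutativeSemigroup = record { isCommutativeSemigroup = +-isCommutativeSemigroup }

  open import Algebra.Properties.CommutativeSemigroup +-commutativeSemigroup using (x∙yz≈y∙xz)

  -- conv g h k = Σ_{i ≤ k} g i * h (k − i), the coefficients of the product of two power series.
  conv : (ℕ → A) → (ℕ → A) → ℕ → A
  conv g h zero    = g 0 * h 0
  conv g h (suc k) = g 0 * h (suc k) + conv (g ∘ suc) h k

  conv-cong : ∀ {g g′ h h′} → g ≗ g′ → h ≗ h′ → conv g h ≗ conv g′ h′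
  conv-cong g≗g′ h≗h′ zero    = cong₂ _*_ (g≗g′ 0) (h≗h′ 0)
  conv-cong g≗g′ h≗h′ (suc k) =
    cong₂ _+_ (cong₂ _*_ (g≗g′ 0) (h≗h′ (suc k))) (conv-cong (g≗g′ ∘ suc) h≗h′ k)

  conv-comm : ∀ g h → conv g h ≗ conv h g
  conv-comm g h zero          = *-comm (g 0) (h 0)
  conv-comm g h (suc zero)    = trans (+-comm _ _) (cong₂ _+_ (*-comm (g 1) (h 0)) (*-comm (g 0) (h 1)))
  conv-comm g h (suc (suc k)) = begin
    g 0 * h (suc (suc k)) + conv (g ∘ suc) h (suc k)
      ≡⟨ cong (g 0 * h (suc (suc k)) +_) (conv-comm (g ∘ suc) h (suc k)) ⟩
    g 0 * h (suc (suc k)) + (h 0 * g (suc (suc k)) + conv (h ∘ suc) (g ∘ suc) k)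
      ≡⟨ x∙yz≈y∙xz _ _ _ ⟩
    h 0 * g (suc (suc k)) + (g 0 * h (suc (suc k)) + conv (h ∘ suc) (g ∘ suc) k)
      ≡⟨ cong (λ c → h 0 * g (suc (suc k)) + (g 0 * h (suc (suc k)) + c)) (conv-comm (h ∘ suc) (g ∘ suc) k) ⟩
    h 0 * g (suc (suc k)) + conv g (h ∘ suc) (suc k)
      ≡⟨ cong (h 0 * g (suc (suc k)) +_) (conv-comm g (h ∘ suc) (suc k)) ⟩
    h 0 * g (suc (suc k)) + conv (h ∘ suc) g (suc k) ∎

  conv-zeroˡ : ∀ g h → (∀ i → g i ≡ 0#) → ∀ k → conv g h k ≡ 0#
  conv-zeroˡ g h g≡0 zero    = trans (cong (_* h 0) (g≡0 0)) (zeroˡ (h 0))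
  conv-zeroˡ g h g≡0 (suc k) = begin
    _ ≡⟨ cong₂ _+_ (trans (cong (_* h (suc k)) (g≡0 0)) (zeroˡ _)) (conv-zeroˡ (g ∘ suc) h (g≡0 ∘ suc) k) ⟩
    0# + 0# ≡⟨ +-identityˡ 0# ⟩
    0# ∎

  conv-zeroʳ : ∀ g h → (∀ i → h i ≡ 0#) → ∀ k → conv g h k ≡ 0#
  conv-zeroʳ g h h≡0 k = trans (conv-comm g h k) (conv-zeroˡ h g h≡0 k)

  conv-constˡ : ∀ g h → (∀ i → g (suc i) ≡ 0#) → ∀ k → conv g h k ≡ g 0 * h k
  conv-constˡ g h g-const zero    = refl
  conv-constˡ g h g-const (suc k) =
    trans (cong (_ +_) (conv-zeroˡ (g ∘ suc) h g-const k)) (+-identityʳ _)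

  conv-linearˡ : ∀ g h → (∀ i → g (suc (suc i)) ≡ 0#) → ∀ k → conv g h (suc k) ≡ g 0 * h (suc k) + g 1 * h k
  conv-linearˡ g h g-linear k = cong (_ +_) (conv-constˡ (g ∘ suc) h g-linear k)

  conv-scaleˡ : ∀ c g h → conv ((c *_) ∘ g) h ≗ (c *_) ∘ conv g h
  conv-scaleˡ c g h zero    = *-assoc c (g 0) (h 0)
  conv-scaleˡ c g h (suc k) = begin
    c * g 0 * h (suc k) + conv ((c *_) ∘ g ∘ suc) h k
      ≡⟨ cong₂ _+_ (*-assoc c (g 0) (h (suc k))) (conv-scaleˡ c (g ∘ suc) h k) ⟩
    c * (g 0 * h (suc k)) + c * conv (g ∘ suc) h k
      ≡⟨ sym (distribˡ c _ _) ⟩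
    c * conv g h (suc k) ∎

  conv-scaleʳ : ∀ c g h → conv g ((c *_) ∘ h) ≗ (c *_) ∘ conv g h
  conv-scaleʳ c g h k = begin
    conv g ((c *_) ∘ h) k ≡⟨ conv-comm g ((c *_) ∘ h) k ⟩
    conv ((c *_) ∘ h) g k ≡⟨ conv-scaleˡ c h g k ⟩
    c * conv h g k        ≡⟨ cong (c *_) (conv-comm h g k) ⟩
    c * conv g h k        ∎

  VanishesAbove : (ℕ → A) → ℕ → Set
  VanishesAbove g r = ∀ i → r < i → g i ≡ 0#

  conv-top : ∀ {g h r s} → VanishesAbove g r → VanishesAbove h s → conv g h (r ℕ.+ s) ≡ g r * h s
  conv-top {g} {h} {zero}  g↑ h↑ = conv-constˡ g h (λ i → g↑ (suc i) (s≤s z≤n)) _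
  conv-top {g} {h} {suc r} {s} g↑ h↑ = begin
    g 0 * h (suc (r ℕ.+ s)) + conv (g ∘ suc) h (r ℕ.+ s)
      ≡⟨ cong₂ _+_ (trans (cong (g 0 *_) (h↑ _ (s≤s (ℕP.m≤n+m s r)))) (zeroʳ (g 0)))
                   (conv-top (λ i r<i → g↑ (suc i) (s≤s r<i)) h↑) ⟩
    0# + g (suc r) * h s ≡⟨ +-identityˡ _ ⟩
    g (suc r) * h s ∎

  conv-vanishesAbove : ∀ {g h r s} → VanishesAbove g r → VanishesAbove h s → VanishesAbove (conv g h) (r ℕ.+ s)
  conv-vanishesAbove {g} {h} {zero} g↑ h↑ k s<k =
    trans (conv-constˡ g h (λ i → g↑ (suc i) (s≤s z≤n)) k) (trans (cong (g 0 *_) (h↑ k s<k)) (zeroʳ (g 0)))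
  conv-vanishesAbove {g} {h} {suc r} {s} g↑ h↑ (suc k) (s≤s r+s<k) = begin
    g 0 * h (suc k) + conv (g ∘ suc) h k
      ≡⟨ cong₂ _+_ (trans (cong (g 0 *_) (h↑ (suc k) (s≤s (ℕP.≤-trans (ℕP.m≤n+m s r) (ℕP.<⇒≤ r+s<k)))))
                          (zeroʳ (g 0)))
                   (conv-vanishesAbove (λ i r<i → g↑ (suc i) (s≤s r<i)) h↑ k r+s<k) ⟩
    0# + 0# ≡⟨ +-identityˡ 0# ⟩
    0# ∎

  module _ (P : A → Set) (P-0# : P 0#) (P-+ : ∀ {x y} → P x → P y → P (x + y))
           (P-* : ∀ x {y} → P y → P (x * y)) where

    conv-∈ : ∀ g h k → (∀ j → j ≤ k → P (h j)) → P (conv g h k)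
    conv-∈ g h zero    h∈P = P-* (g 0) (h∈P 0 z≤n)
    conv-∈ g h (suc k) h∈P =
      P-+ (P-* (g 0) (h∈P (suc k) ℕP.≤-refl))
          (conv-∈ (g ∘ suc) h k (λ j j≤k → h∈P j (ℕP.m≤n⇒m≤1+n j≤k)))

    conv-lowest : ∀ g h I J → (∀ i → i < I → P (g i)) → (∀ j → j < J → P (h j)) →
                  ∃ λ e → P e × conv g h (I ℕ.+ J) ≡ g I * h J + e
    conv-lowest g h zero zero g∈P h∈P = 0# , P-0# , sym (+-identityʳ _)
    conv-lowest g h zero (suc J) g∈P h∈P =
      _ , conv-∈ (g ∘ suc) h J (λ j j≤J → h∈P j (s≤s j≤J)) , refl
    conv-lowest g h (suc I) J g∈P h∈P
      with conv-lowest (g ∘ suc) h I J (λ i i<I → g∈P (suc i) (s≤s i<I)) h∈P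
    ... | e , e∈P , eq = _ , P-+ g₀h∈P e∈P , trans (cong (_ +_) eq) (x∙yz≈y∙xz _ _ _)
      where g₀h∈P = subst P (*-comm _ _) (P-* (h (suc (I ℕ.+ J))) (g∈P 0 (s≤s z≤n)))

  FiniteSupport : (ℕ → A) → Set
  FiniteSupport g = ∃ λ L → ∀ i → L ≤ i → g i ≡ 0#

  HasDegree : (ℕ → A) → ℕ → Set
  HasDegree g r = g r ≢ 0# × VanishesAbove g r

  HasDegree-cong : ∀ {g g′ r} → g ≗ g′ → HasDegree g r → HasDegree g′ r
  HasDegree-cong {r = r} g≗g′ (gr≢0 , g↑) =
    gr≢0 ∘ trans (g≗g′ r) , λ i r<i → trans (sym (g≗g′ i)) (g↑ i r<i)

  HasDegree-unique : ∀ {g r s} → HasDegree g r → HasDegree g s → r ≡ s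
  HasDegree-unique {r = r} {s} (gr≢0 , g↑r) (gs≢0 , g↑s) with ℕP.<-cmp r s
  ... | tri< r<s _ _ = contradiction (g↑r s r<s) gs≢0
  ... | tri≈ _ r≡s _ = r≡s
  ... | tri> _ _ s<r = contradiction (g↑s r s<r) gr≢0

  module _ (_≟0# : ∀ x → Dec (x ≡ 0#)) where

    zero⊎degree : ∀ {g} → FiniteSupport g → (∀ i → g i ≡ 0#) ⊎ ∃ (HasDegree g)
    zero⊎degree {g} (L , g↑) = below L g↑
      where
      below : ∀ L → (∀ i → L ≤ i → g i ≡ 0#) → (∀ i → g i ≡ 0#) ⊎ ∃ (HasDegree g)
      below zero    g↑ = inj₁ (λ i → g↑ i z≤n)
      below (suc L) g↑ with g L ≟0#
      ... | no gL≢0  = inj₂ (L , gL≢0 , g↑)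
      ... | yes gL≡0 = below L (λ i L≤i → [ g↑ i , (λ { refl → gL≡0 }) ]′ (ℕP.m≤n⇒m<n∨m≡n L≤i))

  module _ (noZeroDivisors : ∀ {x y} → x * y ≡ 0# → x ≡ 0# ⊎ y ≡ 0#) where

    conv-degree : ∀ {g h r s} → HasDegree g r → HasDegree h s → HasDegree (conv g h) (r ℕ.+ s)
    conv-degree (gr≢0 , g↑) (hs≢0 , h↑) =
      (λ eq → [ gr≢0 , hs≢0 ]′ (noZeroDivisors (trans (sym (conv-top g↑ h↑)) eq))) ,
      conv-vanishesAbove g↑ h↑

MinimalCounterexample : (ℕ → Set) → Set
MinimalCounterexample P = ∃ λ I → ¬ P I × (∀ i → i < I → P i)

all⊎minimalCounterexample : ∀ {P : ℕ → Set} → (∀ i → Dec (P i)) → ∀ L → (∀ i → L ≤ i → P i) →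
                            (∀ i → P i) ⊎ MinimalCounterexample P
all⊎minimalCounterexample {P} P? L P≥L with below L
  where
  below : ∀ L → (∀ i → i < L → P i) ⊎ MinimalCounterexample P
  below zero = inj₁ (λ _ ())
  below (suc L) with below L | P? L
  ... | inj₂ min    | _       = inj₂ min
  ... | inj₁ P<L    | no ¬PL  = inj₂ (L , ¬PL , P<L)
  ... | inj₁ P<L    | yes PL  = inj₁ (λ i i<1+L → [ P<L i , (λ { refl → PL }) ]′ (ℕP.m<1+n⇒m<n∨m≡n i<1+L))
... | inj₂ min = inj₂ min
... | inj₁ P<L = inj₁ (λ i → [ P<L i , P≥L i ]′ (ℕP.<-≤-connex i L))

open import Data.Integer as ℤ using (ℤ; +_; -[1+_]; -1ℤ)
import Data.Integer.Properties as ℤP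
open import Data.Integer.Divisibility.Signed as ℤ∣ using () renaming (_∣_ to _∣ℤ_)
open import Data.Integer.GCD using (gcd)
open import Data.Integer.Tactic.RingSolver using (solve-∀)
open import Data.List using (List; []; _∷_; map; length; _++_)
open import Data.List.Relation.Unary.All using (All; []; _∷_)
open import Data.Nat using (_+_)
open import Data.Nat.Coprimality using (1-coprimeTo) renaming (sym to coprime-sym)
open import Data.Nat.Divisibility as ℕ∣ using (_∣_)
open import Data.Nat.ListAction using (product)
open import Data.Nat.Primality using (Prime; euclidsLemma; prime⇒irreducible; prime⇒nonTrivial; prime⇒nonZero)
open import Data.Nat.Primality.Factorisation using (factorise; PrimeFactorisation)
open import Data.Rational as ℚ using (ℚ; mkℚ; 0ℚ; 1ℚ)
import Data.Rational.Properties as ℚP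
import Data.Rational.Unnormalised as ℚᵘ
import Data.Rational.Unnormalised.Properties as ℚᵘP
open import Function.Construct.Composition using (_⇔-∘_)
open import Algebra.Properties.CommutativeSemigroup (CommutativeRing.*-commutativeSemigroup ℚP.+-*-commutativeRing)
  using (xy∙z≈xz∙y; x∙yz≈xy∙z)

open import Defs

-- The embedding through which fPoly states its coefficients (+ a ℚ./ 1).
ι : ℤ → ℚ
ι z = z ℚ./ 1

ι-mkℚ : ∀ z → ι z ≡ mkℚ z 0 (coprime-sym (1-coprimeTo ℤ.∣ z ∣))
ι-mkℚ (+ n)    = ℚP.normalize-coprime (coprime-sym (1-coprimeTo n))
ι-mkℚ -[1+ n ] = cong ℚ.-_ (ℚP.normalize-coprime (coprime-sym (1-coprimeTo (suc n))))

ι-injective : ∀ {x y} → ι x ≡ ι y → x ≡ y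
ι-injective {x} {y} eq rewrite ι-mkℚ x | ι-mkℚ y = cong ℚ.↥_ eq

ι-homo-+ : ∀ x y → ι (x ℤ.+ y) ≡ ι x ℚ.+ ι y
ι-homo-+ x y rewrite ι-mkℚ x | ι-mkℚ y =
  cong (ℚ._/ 1) (sym (cong₂ ℤ._+_ (ℤP.*-identityʳ x) (ℤP.*-identityʳ y)))

ι-homo-* : ∀ x y → ι (x ℤ.* y) ≡ ι x ℚ.* ι y
ι-homo-* x y rewrite ι-mkℚ x | ι-mkℚ y = refl

ι-homo-pos* : ∀ m n → ι (+ (m ℕ.* n)) ≡ ι (+ m) ℚ.* ι (+ n)
ι-homo-pos* m n = trans (cong ι (ℤP.pos-* m n)) (ι-homo-* (+ m) (+ n))

ι-homo‿- : ∀ x → ι (ℤ.- x) ≡ ℚ.- ι x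
ι-homo‿- x rewrite ι-mkℚ x | ι-mkℚ (ℤ.- x) with x
... | + zero   = refl
... | + suc n  = refl
... | -[1+ n ] = refl

ι-homo-− : ∀ x y → ι (x ℤ.- y) ≡ ι x ℚ.- ι y
ι-homo-− x y = trans (ι-homo-+ x (ℤ.- y)) (cong (ι x ℚ.+_) (ι-homo‿- y))

ι-↧*≡ι-↥ : ∀ c → ι (ℚ.↧ c) ℚ.* c ≡ ι (ℚ.↥ c)
ι-↧*≡ι-↥ c@(mkℚ n d _) =
  ℚP.toℚᵘ-injective (ℚᵘP.≃-trans (ℚP.toℚᵘ-homo-* (ι (+ suc d)) c) unnormalised)
  where
  swap : ∀ (x y : ℤ) → (x ℤ.* y) ℤ.* + 1 ≡ y ℤ.* x
  swap = solve-∀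
  unnormalised : ℚ.toℚᵘ (ι (+ suc d)) ℚᵘ.* ℚ.toℚᵘ c ℚᵘ.≃ ℚ.toℚᵘ (ι n)
  unnormalised rewrite ι-mkℚ (+ suc d) | ι-mkℚ n | ℕP.+-identityʳ d = ℚᵘ.*≡* (swap (+ suc d) n)

module ℤ-conv = Convolution (IsCommutativeSemiring.isCommutativeSemiringWithoutOne ℤP.+-*-isCommutativeSemiring)
module ℚ-conv = Convolution (IsCommutativeSemiring.isCommutativeSemiringWithoutOne
                               (IsCommutativeRing.isCommutativeSemiring ℚP.+-*-isCommutativeRing))
open ℤ-conv

ι-homo-conv : ∀ G H k → ι (conv G H k) ≡ ℚ-conv.conv (ι ∘ G) (ι ∘ H) k
ι-homo-conv G H zero    = ι-homo-* (G 0) (H 0)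
ι-homo-conv G H (suc k) = trans (ι-homo-+ (G 0 ℤ.* H (suc k)) (conv (G ∘ suc) H k))
                                (cong₂ ℚ._+_ (ι-homo-* (G 0) (H (suc k))) (ι-homo-conv (G ∘ suc) H k))

ℚ-noZeroDivisors : ∀ {x y} → x ℚ.* y ≡ 0ℚ → x ≡ 0ℚ ⊎ y ≡ 0ℚ
ℚ-noZeroDivisors {x} {y} xy≡0 =
  Sum.map (ℚP.↥p≡0⇒p≡0 x) (ℚP.↥p≡0⇒p≡0 y) (ℤP.i*j≡0⇒i≡0∨j≡0 (ℚ.↥ x) ↥x*↥y≡0)
  where
  ↥x*↥y≡0 : ℚ.↥ x ℤ.* ℚ.↥ y ≡ + 0
  ↥x*↥y≡0 = trans (sym (ℚP.↥-* x y))
                  (trans (cong (ℤ._* nf) (ℚP.p≡0⇒↥p≡0 (x ℚ.* y) xy≡0)) (ℤP.*-zeroˡ nf))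
    where nf = gcd (ℚ.↥ x ℤ.* ℚ.↥ y) (ℚ.↧ x ℤ.* ℚ.↧ y)

coeff-+ : ∀ f g k → coeff (f +ₚ g) k ≡ coeff f k ℚ.+ coeff g k
coeff-+ []       g        k       = sym (ℚP.+-identityˡ (coeff g k))
coeff-+ (c ∷ cs) []       k       = sym (ℚP.+-identityʳ (coeff (c ∷ cs) k))
coeff-+ (c ∷ cs) (d ∷ ds) zero    = refl
coeff-+ (c ∷ cs) (d ∷ ds) (suc k) = coeff-+ cs ds k

coeff-map : ∀ (φ : ℚ → ℚ) → φ 0ℚ ≡ 0ℚ → ∀ f k → coeff (map φ f) k ≡ φ (coeff f k)
coeff-map φ φ0≡0 []       k       = sym φ0≡0
coeff-map φ φ0≡0 (c ∷ cs) zero    = refl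
coeff-map φ φ0≡0 (c ∷ cs) (suc k) = coeff-map φ φ0≡0 cs k

coeff-− : ∀ f g k → coeff (f -ₚ g) k ≡ coeff f k ℚ.- coeff g k
coeff-− f g k = trans (coeff-+ f (-ₚ g) k) (cong (coeff f k ℚ.+_) (coeff-map ℚ.-_ refl g k))

coeff-* : ∀ f g → coeff (f *ₚ g) ≗ ℚ-conv.conv (coeff f) (coeff g)
coeff-* []       g k       = sym (ℚ-conv.conv-zeroˡ (coeff []) (coeff g) (λ _ → refl) k)
coeff-* (c ∷ cs) g zero    =
  trans (coeff-+ (map (c ℚ.*_) g) (0ℚ ∷ (cs *ₚ g)) 0)
        (trans (ℚP.+-identityʳ _) (coeff-map (c ℚ.*_) (ℚP.*-zeroʳ c) g 0))
coeff-* (c ∷ cs) g (suc k) =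
  trans (coeff-+ (map (c ℚ.*_) g) (0ℚ ∷ (cs *ₚ g)) (suc k))
        (cong₂ ℚ._+_ (coeff-map (c ℚ.*_) (ℚP.*-zeroʳ c) g (suc k)) (coeff-* cs g k))

coeff-const* : ∀ c g k → coeff (const c *ₚ g) k ≡ c ℚ.* coeff g k
coeff-const* c g k = trans (coeff-* (const c) g k) (ℚ-conv.conv-constˡ (coeff (const c)) (coeff g) (λ _ → refl) k)

coeff-beyond : ∀ f i → length f ≤ i → coeff f i ≡ 0ℚ
coeff-beyond []       i       _         = refl
coeff-beyond (c ∷ cs) (suc i) (s≤s len≤i) = coeff-beyond cs i len≤i

coeff-finite : ∀ f → ℚ-conv.FiniteSupport (coeff f)
coeff-finite f = length f , coeff-beyond f

δ : ℕ → ℕ → ℤ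
δ zero    zero    = + 1
δ zero    (suc k) = + 0
δ (suc n) zero    = + 0
δ (suc n) (suc k) = δ n k

δ-≢ : ∀ {m k} → m ≢ k → δ m k ≡ + 0
δ-≢ {zero}  {zero}  0≢0 = contradiction refl 0≢0
δ-≢ {zero}  {suc k} _   = refl
δ-≢ {suc m} {zero}  _   = refl
δ-≢ {suc m} {suc k} m≢k = δ-≢ (m≢k ∘ cong suc)

δ-diag : ∀ m → δ m m ≡ + 1
δ-diag zero    = refl
δ-diag (suc m) = δ-diag m

coeff-const : ∀ c k → coeff (const c) k ≡ c ℚ.* ι (δ 0 k)
coeff-const c zero    = sym (ℚP.*-identityʳ c)
coeff-const c (suc k) = sym (ℚP.*-zeroʳ c)

coeff-X^ : ∀ n k → coeff (X ^ₚ n) k ≡ ι (δ n k)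
coeff-X^ zero    k       = trans (coeff-const 1ℚ k) (ℚP.*-identityˡ _)
coeff-X^ (suc n) zero    = trans (coeff-* X (X ^ₚ n) 0) (ℚP.*-zeroˡ (coeff (X ^ₚ n) 0))
coeff-X^ (suc n) (suc k) = begin
  coeff (X *ₚ X ^ₚ n) (suc k)                          ≡⟨ coeff-* X (X ^ₚ n) (suc k) ⟩
  ℚ-conv.conv (coeff X) (coeff (X ^ₚ n)) (suc k)
    ≡⟨ ℚ-conv.conv-linearˡ (coeff X) (coeff (X ^ₚ n)) (λ _ → refl) k ⟩
  0ℚ ℚ.* coeff (X ^ₚ n) (suc k) ℚ.+ 1ℚ ℚ.* coeff (X ^ₚ n) k
    ≡⟨ cong₂ ℚ._+_ (ℚP.*-zeroˡ (coeff (X ^ₚ n) (suc k))) (ℚP.*-identityˡ (coeff (X ^ₚ n) k)) ⟩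
  0ℚ ℚ.+ coeff (X ^ₚ n) k                              ≡⟨ ℚP.+-identityˡ (coeff (X ^ₚ n) k) ⟩
  coeff (X ^ₚ n) k                                     ≡⟨ coeff-X^ n k ⟩
  ι (δ n k) ∎
  where open ≡-Reasoning

fCoeff : ℕ → ℕ → ℕ → ℕ → ℤ
fCoeff n a p k = δ n k ℤ.- + a ℤ.* δ (n ∸ 1) k ℤ.- + p ℤ.* δ 0 k

coeff-fPoly : ∀ n a p k → coeff (fPoly n a p) k ≡ ι (fCoeff n a p k)
coeff-fPoly n a p k = begin
  coeff (fPoly n a p) k
    ≡⟨ trans (coeff-− (X ^ₚ n -ₚ aXⁿ⁻¹) (const (ι (+ p))) k)
             (cong (ℚ._- _) (coeff-− (X ^ₚ n) aXⁿ⁻¹ k)) ⟩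
  coeff (X ^ₚ n) k ℚ.- coeff aXⁿ⁻¹ k ℚ.- coeff (const (ι (+ p))) k
    ≡⟨ cong₂ ℚ._-_ (cong₂ ℚ._-_ (coeff-X^ n k) (trans (coeff-const* (ι (+ a)) (X ^ₚ (n ∸ 1)) k)
                                                        (cong (ι (+ a) ℚ.*_) (coeff-X^ (n ∸ 1) k))))
                   (coeff-const (ι (+ p)) k) ⟩
  ι (δ n k) ℚ.- ι (+ a) ℚ.* ι (δ (n ∸ 1) k) ℚ.- ι (+ p) ℚ.* ι (δ 0 k)
    ≡⟨ sym (trans (ι-homo-− (δ n k ℤ.- + a ℤ.* δ (n ∸ 1) k) (+ p ℤ.* δ 0 k))
                  (cong₂ ℚ._-_ (trans (ι-homo-− (δ n k) (+ a ℤ.* δ (n ∸ 1) k))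
                                      (cong (λ x → ι (δ n k) ℚ.- x) (ι-homo-* (+ a) (δ (n ∸ 1) k))))
                               (ι-homo-* (+ p) (δ 0 k)))) ⟩
  ι (fCoeff n a p k) ∎
  where
  open ≡-Reasoning
  aXⁿ⁻¹ : Poly
  aXⁿ⁻¹ = const (ι (+ a)) *ₚ X ^ₚ (n ∸ 1)

nonzeroConstant⇒unit : ∀ g → ℚ-conv.HasDegree (coeff g) 0 → IsUnit g
nonzeroConstant⇒unit g (g₀≢0 , g↑) = c , gc≈1
  where
  instance _ = ℚ.≢-nonZero g₀≢0
  c : Poly
  c = const (ℚ.1/ coeff g 0)
  scaled : ∀ k → ℚ.1/ coeff g 0 ℚ.* coeff g k ≡ coeff (const 1ℚ) k
  scaled zero    = ℚP.*-inverseˡ (coeff g 0)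
  scaled (suc k) = trans (cong (ℚ.1/ coeff g 0 ℚ.*_) (g↑ (suc k) (s≤s z≤n))) (ℚP.*-zeroʳ (ℚ.1/ coeff g 0))
  gc≈1 : g *ₚ c ≈ₚ const 1ℚ
  gc≈1 k = begin
    coeff (g *ₚ c) k                     ≡⟨ coeff-* g c k ⟩
    ℚ-conv.conv (coeff g) (coeff c) k    ≡⟨ ℚ-conv.conv-comm (coeff g) (coeff c) k ⟩
    ℚ-conv.conv (coeff c) (coeff g) k    ≡⟨ ℚ-conv.conv-constˡ (coeff c) (coeff g) (λ _ → refl) k ⟩
    ℚ.1/ coeff g 0 ℚ.* coeff g k         ≡⟨ scaled k ⟩
    coeff (const 1ℚ) k ∎
    where open ≡-Reasoning

nonconstant⇒nonunit : ∀ g k → coeff g (suc k) ≢ 0ℚ → ¬ IsUnit g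
nonconstant⇒nonunit g k g₁₊ₖ≢0 (g′ , gg′≈1)
  with ℚ-conv.zero⊎degree (ℚP._≟ 0ℚ) (coeff-finite g) | ℚ-conv.zero⊎degree (ℚP._≟ 0ℚ) (coeff-finite g′)
... | inj₁ g≡0 | _ = g₁₊ₖ≢0 (g≡0 (suc k))
... | inj₂ _   | inj₁ g′≡0 =
  ℚP.1≢0 (trans (sym (gg′≈1 0)) (trans (coeff-* g g′ 0) (ℚ-conv.conv-zeroʳ (coeff g) (coeff g′) g′≡0 0)))
... | inj₂ (r , deg-g) | inj₂ (s , deg-g′) =
  proj₁ (ℚ-conv.conv-degree ℚ-noZeroDivisors deg-g deg-g′)
        (trans (sym (coeff-* g g′ (r + s))) (trans (gg′≈1 (r + s)) (const-vanishes 0<r+s)))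
  where
  const-vanishes : ∀ {m} → 0 < m → coeff (const 1ℚ) m ≡ 0ℚ
  const-vanishes {suc m} _ = refl
  1+k≤r : suc k ≤ r
  1+k≤r = ℕP.≮⇒≥ (λ r<1+k → g₁₊ₖ≢0 (proj₂ deg-g (suc k) r<1+k))
  0<r+s : 0 < r + s
  0<r+s = ℕP.<-≤-trans (s≤s z≤n) (ℕP.≤-trans 1+k≤r (ℕP.m≤m+n r s))

x≡0⇒q∣x : ∀ {q x} → x ≡ + 0 → q ∣ℤ x
x≡0⇒q∣x refl = ℤ∣.divides (+ 0) refl

euclidsLemmaℤ : ∀ {q} x y → Prime q → + q ∣ℤ x ℤ.* y → + q ∣ℤ x ⊎ + q ∣ℤ y
euclidsLemmaℤ {q} x y q-prime q∣xy = Sum.map ℤ∣.∣ᵤ⇒∣ ℤ∣.∣ᵤ⇒∣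
  (euclidsLemma ℤ.∣ x ∣ ℤ.∣ y ∣ q-prime (subst (q ℕ∣.∣_) (ℤP.abs-* x y) (ℤ∣.∣⇒∣ᵤ q∣xy)))

conv-lowest-mod : ∀ q G H I J → (∀ i → i < I → q ∣ℤ G i) → (∀ j → j < J → q ∣ℤ H j) →
                  ∃ λ e → q ∣ℤ e × conv G H (I + J) ≡ G I ℤ.* H J ℤ.+ e
conv-lowest-mod q = conv-lowest (q ∣ℤ_) (x≡0⇒q∣x refl) ℤ∣.∣m∣n⇒∣m+n ℤ∣.∣n⇒∣m*n

prime∣conv⇒prime∣factor : ∀ {q G H} → Prime q → FiniteSupport G → FiniteSupport H →
                          (∀ k → + q ∣ℤ conv G H k) → (∀ i → + q ∣ℤ G i) ⊎ (∀ j → + q ∣ℤ H j)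
prime∣conv⇒prime∣factor {q} {G} {H} q-prime (LG , G↑) (LH , H↑) q∣GH
  with all⊎minimalCounterexample (λ i → + q ℤ∣.∣? G i) LG (λ i LG≤i → x≡0⇒q∣x (G↑ i LG≤i))
     | all⊎minimalCounterexample (λ j → + q ℤ∣.∣? H j) LH (λ j LH≤j → x≡0⇒q∣x (H↑ j LH≤j))
... | inj₁ q∣G | _        = inj₁ q∣G
... | inj₂ _   | inj₁ q∣H = inj₂ q∣H
... | inj₂ (I , q∤GI , q∣G<I) | inj₂ (J , q∤HJ , q∣H<J) with conv-lowest-mod (+ q) G H I J q∣G<I q∣H<J
... | e , q∣e , GH≡ = contradiction q∣GIHJ (Sum.[ q∤GI , q∤HJ ]′ ∘ euclidsLemmaℤ (G I) (H J) q-prime)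
  where q∣GIHJ = ℤ∣.∣m+n∣n⇒∣m (subst (+ q ∣ℤ_) GH≡ (q∣GH (I + J))) q∣e

denominator : Poly → ℕ
denominator []       = 1
denominator (c ∷ cs) = ℚ.↧ₙ c ℕ.* denominator cs

denominator≢0 : ∀ f → denominator f ≢ 0
denominator≢0 []                     ()
denominator≢0 (c@(mkℚ _ _ _) ∷ cs) eq with ℕP.m*n≡0⇒m≡0∨n≡0 (ℚ.↧ₙ c) eq
... | inj₂ d≡0 = denominator≢0 cs d≡0

numerators : Poly → ℕ → ℤ
numerators []       i       = + 0
numerators (c ∷ cs) zero    = ℚ.↥ c ℤ.* + denominator cs
numerators (c ∷ cs) (suc i) = ℚ.↧ c ℤ.* numerators cs i

ι-numerators : ∀ f i → ι (numerators f i) ≡ ι (+ denominator f) ℚ.* coeff f i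
ι-numerators []       i       = sym (ℚP.*-zeroʳ 1ℚ)
ι-numerators (c ∷ cs) zero    = begin
  ι (ℚ.↥ c ℤ.* + denominator cs)                    ≡⟨ ι-homo-* (ℚ.↥ c) (+ denominator cs) ⟩
  ι (ℚ.↥ c) ℚ.* ι (+ denominator cs)                ≡⟨ cong (ℚ._* ι (+ denominator cs)) (ι-↧*≡ι-↥ c) ⟨
  ι (ℚ.↧ c) ℚ.* c ℚ.* ι (+ denominator cs)          ≡⟨ xy∙z≈xz∙y (ι (ℚ.↧ c)) c _ ⟩
  ι (ℚ.↧ c) ℚ.* ι (+ denominator cs) ℚ.* c          ≡⟨ cong (ℚ._* c) (ι-homo-pos* (ℚ.↧ₙ c) (denominator cs)) ⟨
  ι (+ denominator (c ∷ cs)) ℚ.* c                  ∎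
  where open ≡-Reasoning
ι-numerators (c ∷ cs) (suc i) = begin
  ι (ℚ.↧ c ℤ.* numerators cs i)                           ≡⟨ ι-homo-* (ℚ.↧ c) (numerators cs i) ⟩
  ι (ℚ.↧ c) ℚ.* ι (numerators cs i)                       ≡⟨ cong (ι (ℚ.↧ c) ℚ.*_) (ι-numerators cs i) ⟩
  ι (ℚ.↧ c) ℚ.* (ι (+ denominator cs) ℚ.* coeff cs i)     ≡⟨ x∙yz≈xy∙z (ι (ℚ.↧ c)) _ _ ⟩
  ι (ℚ.↧ c) ℚ.* ι (+ denominator cs) ℚ.* coeff cs i
    ≡⟨ cong (ℚ._* coeff cs i) (ι-homo-pos* (ℚ.↧ₙ c) (denominator cs)) ⟨
  ι (+ denominator (c ∷ cs)) ℚ.* coeff cs i               ∎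
  where open ≡-Reasoning

numerators-finite : ∀ f → ℤ-conv.FiniteSupport (numerators f)
numerators-finite f = length f , beyond f
  where
  beyond : ∀ f i → length f ≤ i → numerators f i ≡ + 0
  beyond []       i       _           = refl
  beyond (c ∷ cs) (suc i) (s≤s len≤i) = trans (cong (ℚ.↧ c ℤ.*_) (beyond cs i len≤i)) (ℤP.*-zeroʳ (ℚ.↧ c))

numerators≡0⇔coeff≡0 : ∀ f i → numerators f i ≡ + 0 ⇔ coeff f i ≡ 0ℚ
numerators≡0⇔coeff≡0 f i = mk⇔ to from
  where
  ιd≢0 : ι (+ denominator f) ≢ 0ℚ
  ιd≢0 eq = denominator≢0 f (ℤP.+-injective (ι-injective eq))
  to : numerators f i ≡ + 0 → coeff f i ≡ 0ℚ
  to eq = Sum.[ ⊥-elim ∘ ιd≢0 , id ]′ (ℚ-noZeroDivisors (trans (sym (ι-numerators f i)) (cong ι eq)))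
  from : coeff f i ≡ 0ℚ → numerators f i ≡ + 0
  from eq = ι-injective (trans (ι-numerators f i)
                               (trans (cong (ι (+ denominator f) ℚ.*_) eq) (ℚP.*-zeroʳ (ι (+ denominator f)))))

record IntegralFactorisation (D : ℕ) (F : ℕ → ℤ) (g h : Poly) : Set where
  field
    G H      : ℕ → ℤ
    G-finite : FiniteSupport G
    H-finite : FiniteSupport H
    G≡0⇔g≡0  : ∀ i → G i ≡ + 0 ⇔ coeff g i ≡ 0ℚ
    H≡0⇔h≡0  : ∀ i → H i ≡ + 0 ⇔ coeff h i ≡ 0ℚ
    GH≡DF    : ∀ k → conv G H k ≡ + D ℤ.* F k

clearDenominators : ∀ {t F} g h → (∀ k → coeff t k ≡ ι (F k)) → t ≈ₚ g *ₚ h →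
                    IntegralFactorisation (denominator g ℕ.* denominator h) F g h
clearDenominators {F = F} g h t≡F t≈gh = record
  { G = numerators g ; H = numerators h
  ; G-finite = numerators-finite g ; H-finite = numerators-finite h
  ; G≡0⇔g≡0 = numerators≡0⇔coeff≡0 g ; H≡0⇔h≡0 = numerators≡0⇔coeff≡0 h
  ; GH≡DF = λ k → ι-injective (cleared k) }
  where
  dg dh : ℚ
  dg = ι (+ denominator g)
  dh = ι (+ denominator h)
  cleared : ∀ k → ι (conv (numerators g) (numerators h) k) ≡ ι (+ (denominator g ℕ.* denominator h) ℤ.* F k)
  cleared k = begin
    ι (conv (numerators g) (numerators h) k)
      ≡⟨ ι-homo-conv (numerators g) (numerators h) k ⟩
    ℚ-conv.conv (ι ∘ numerators g) (ι ∘ numerators h) k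
      ≡⟨ ℚ-conv.conv-cong (ι-numerators g) (ι-numerators h) k ⟩
    ℚ-conv.conv ((dg ℚ.*_) ∘ coeff g) ((dh ℚ.*_) ∘ coeff h) k
      ≡⟨ ℚ-conv.conv-scaleˡ dg (coeff g) _ k ⟩
    dg ℚ.* ℚ-conv.conv (coeff g) ((dh ℚ.*_) ∘ coeff h) k
      ≡⟨ cong (dg ℚ.*_) (ℚ-conv.conv-scaleʳ dh (coeff g) (coeff h) k) ⟩
    dg ℚ.* (dh ℚ.* ℚ-conv.conv (coeff g) (coeff h) k)
      ≡⟨ cong (λ c → dg ℚ.* (dh ℚ.* c)) (trans (sym (coeff-* g h k)) (trans (sym (t≈gh k)) (t≡F k))) ⟩
    dg ℚ.* (dh ℚ.* ι (F k))
      ≡⟨ x∙yz≈xy∙z dg dh (ι (F k)) ⟩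
    dg ℚ.* dh ℚ.* ι (F k)
      ≡⟨ cong (ℚ._* ι (F k)) (ι-homo-pos* (denominator g) (denominator h)) ⟨
    ι (+ (denominator g ℕ.* denominator h)) ℚ.* ι (F k)
      ≡⟨ ι-homo-* (+ (denominator g ℕ.* denominator h)) (F k) ⟨
    ι (+ (denominator g ℕ.* denominator h) ℤ.* F k) ∎
    where open ≡-Reasoning

swap : ∀ {D F g h} → IntegralFactorisation D F g h → IntegralFactorisation D F h g
swap φ = record
  { G = H ; H = G ; G-finite = H-finite ; H-finite = G-finite ; G≡0⇔g≡0 = H≡0⇔h≡0 ; H≡0⇔h≡0 = G≡0⇔g≡0
  ; GH≡DF = λ k → trans (conv-comm H G k) (GH≡DF k) }
  where open IntegralFactorisation φ

divideOutˡ : ∀ {q D F g h} .{{_ : ℕ.NonZero q}} (φ : IntegralFactorisation (q ℕ.* D) F g h) →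
             (∀ i → + q ∣ℤ IntegralFactorisation.G φ i) → IntegralFactorisation D F g h
divideOutˡ {q} {D} {F} φ q∣G = record
  { G = G′ ; H = H
  ; G-finite = proj₁ G-finite , (λ i L≤i → Equivalence.from (G′≡0⇔G≡0 i) (proj₂ G-finite i L≤i))
  ; H-finite = H-finite
  ; G≡0⇔g≡0 = λ i → G≡0⇔g≡0 i ⇔-∘ G′≡0⇔G≡0 i ; H≡0⇔h≡0 = H≡0⇔h≡0
  ; GH≡DF = λ k → ℤP.*-cancelˡ-≡ (+ q) _ _ (qG′H≡qDF k) }
  where
  open IntegralFactorisation φ
  G′ : ℕ → ℤ
  G′ i = ℤ∣._∣_.quotient (q∣G i)
  G≡G′q : ∀ i → G i ≡ G′ i ℤ.* + q
  G≡G′q i = ℤ∣._∣_.equality (q∣G i)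
  G′≡0⇔G≡0 : ∀ i → G′ i ≡ + 0 ⇔ G i ≡ + 0
  G′≡0⇔G≡0 i = mk⇔ (λ G′i≡0 → trans (G≡G′q i) (cong (ℤ._* + q) G′i≡0))
                   (λ Gi≡0 → ℤP.*-cancelʳ-≡ (G′ i) (+ 0) (+ q) (trans (sym (G≡G′q i)) Gi≡0))
  qG′H≡qDF : ∀ k → + q ℤ.* conv G′ H k ≡ + q ℤ.* (+ D ℤ.* F k)
  qG′H≡qDF k = begin
    + q ℤ.* conv G′ H k             ≡⟨ conv-scaleˡ (+ q) G′ H k ⟨
    conv ((+ q ℤ.*_) ∘ G′) H k      ≡⟨ conv-cong (λ i → trans (ℤP.*-comm (+ q) (G′ i)) (sym (G≡G′q i)))
                                                  (λ _ → refl) k ⟩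
    conv G H k                      ≡⟨ GH≡DF k ⟩
    + (q ℕ.* D) ℤ.* F k             ≡⟨ cong (ℤ._* F k) (ℤP.pos-* q D) ⟩
    + q ℤ.* + D ℤ.* F k             ≡⟨ ℤP.*-assoc (+ q) (+ D) (F k) ⟩
    + q ℤ.* (+ D ℤ.* F k)           ∎
    where open ≡-Reasoning

divideOutPrime : ∀ {q D F g h} → Prime q → IntegralFactorisation (q ℕ.* D) F g h → IntegralFactorisation D F g h
divideOutPrime {q} {D} {F} q-prime φ =
  Sum.[ divideOutˡ φ , swap ∘ divideOutˡ (swap φ) ]′ (prime∣conv⇒prime∣factor q-prime G-finite H-finite q∣GH)
  where
  open IntegralFactorisation φ
  instance _ = prime⇒nonZero q-prime
  q∣GH : ∀ k → + q ∣ℤ conv G H k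
  q∣GH k = subst (+ q ∣ℤ_) (sym (trans (GH≡DF k) (cong (ℤ._* F k) (ℤP.pos-* q D))))
                 (ℤ∣.∣m⇒∣m*n (F k) (ℤ∣.∣m⇒∣m*n (+ D) ℤ∣.∣-refl))

gaussLemma : ∀ {D F g h} → D ≢ 0 → IntegralFactorisation D F g h → IntegralFactorisation 1 F g h
gaussLemma {D} {F} {g} {h} D≢0 φ =
  divideAll factors factorsPrime (subst (λ d → IntegralFactorisation d F g h) isFactorisation φ)
  where
  open PrimeFactorisation (factorise D {{ℕ.≢-nonZero D≢0}})
  divideAll : ∀ qs → All Prime qs → IntegralFactorisation (product qs) F g h → IntegralFactorisation 1 F g h
  divideAll []       []                     ψ = ψ
  divideAll (q ∷ qs) (q-prime ∷ qs-prime) ψ = divideAll qs qs-prime (divideOutPrime q-prime ψ)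

Exceptional : ℕ → ℕ → ℕ → Set
Exceptional n a p = 2 ∣ n × p ≡ a + 1

module CoefficientsOfF (n′ a p : ℕ) where

  n : ℕ
  n = suc (suc n′)

  F : ℕ → ℤ
  F = fCoeff n a p

  private
    only-first : ∀ x A P → x ℤ.- A ℤ.* + 0 ℤ.- P ℤ.* + 0 ≡ x
    only-first = solve-∀
    only-second : ∀ A P → + 0 ℤ.- A ℤ.* + 1 ℤ.- P ℤ.* + 0 ≡ ℤ.- A
    only-second = solve-∀
    only-third : ∀ A P → + 0 ℤ.- A ℤ.* + 0 ℤ.- P ℤ.* + 1 ≡ ℤ.- P
    only-third = solve-∀

  F-vanishes : ∀ {k} → n ≢ k → suc n′ ≢ k → 0 ≢ k → F k ≡ + 0
  F-vanishes n≢k n-1≢k 0≢k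
    rewrite δ-≢ n≢k | δ-≢ n-1≢k | δ-≢ 0≢k = only-first (+ 0) (+ a) (+ p)

  F-top : F n ≡ + 1
  F-top rewrite δ-≢ {suc n′} {n} (ℕP.<⇒≢ ℕP.≤-refl) | δ-diag n = only-first (+ 1) (+ a) (+ p)

  F-degree : HasDegree F n
  F-degree = (λ F-n≡0 → contradiction (trans (sym F-top) F-n≡0) λ ()) ,
             λ k n<k → F-vanishes (ℕP.<⇒≢ n<k) (ℕP.<⇒≢ (ℕP.<-trans ℕP.≤-refl n<k))
                                  (λ { refl → contradiction n<k λ () })

  F-subleading : F (suc n′) ≡ ℤ.- + a
  F-subleading rewrite δ-≢ {n} {suc n′} (ℕP.>⇒≢ ℕP.≤-refl) | δ-diag (suc n′) = only-second (+ a) (+ p)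

  F-constant : F 0 ≡ ℤ.- + p
  F-constant = only-third (+ a) (+ p)

  F-middle : ∀ {k} → suc k < suc n′ → F (suc k) ≡ + 0
  F-middle 1+k<1+n′ = F-vanishes (ℕP.>⇒≢ (ℕP.<-trans 1+k<1+n′ ℕP.≤-refl)) (ℕP.>⇒≢ 1+k<1+n′) λ ()

  p∣F-low : ∀ {k} → k < suc n′ → + p ∣ℤ F k
  p∣F-low {zero}  _      = ℤ∣.divides -1ℤ (trans F-constant (sym (ℤP.-1*i≡-i (+ p))))
  p∣F-low {suc k} k<1+n′ = x≡0⇒q∣x (F-middle k<1+n′)

∣i∣≡1⇒i≡±1 : ∀ {i} → ℤ.∣ i ∣ ≡ 1 → i ≡ + 1 ⊎ i ≡ -1ℤ
∣i∣≡1⇒i≡±1 {+ _}      refl = inj₁ refl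
∣i∣≡1⇒i≡±1 { -[1+ _ ]} refl = inj₂ refl

∣i∣≡n⇒i≡±n : ∀ {i n} → ℤ.∣ i ∣ ≡ n → i ≡ + n ⊎ i ≡ ℤ.- + n
∣i∣≡n⇒i≡±n {+ _}      refl = inj₁ refl
∣i∣≡n⇒i≡±n { -[1+ _ ]} refl = inj₂ refl

abs-^ : ∀ i m → ℤ.∣ i ℤ.^ m ∣ ≡ ℤ.∣ i ∣ ℕ.^ m
abs-^ i zero    = refl
abs-^ i (suc m) = trans (ℤP.abs-* i (i ℤ.^ m)) (cong (ℤ.∣ i ∣ ℕ.*_) (abs-^ i m))

-1^-parity : ∀ m → (2 ∣ m × -1ℤ ℤ.^ m ≡ + 1) ⊎ (2 ∣ suc m × -1ℤ ℤ.^ m ≡ -1ℤ)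
-1^-parity zero    = inj₁ (ℕ∣._∣0 2 , refl)
-1^-parity (suc m) with -1^-parity m
... | inj₁ (2∣m   , -1^m≡1)  = inj₂ (ℕ∣.∣m∣n⇒∣m+n (ℕ∣.∣-refl {2}) 2∣m , cong (-1ℤ ℤ.*_) -1^m≡1)
... | inj₂ (2∣1+m , -1^m≡-1) = inj₁ (2∣1+m , cong (-1ℤ ℤ.*_) -1^m≡-1)

module RootsOfF (a p : ℕ) (p-prime : Prime p) where

  -- u is a root of f_{n,a,p} with n = 2 + n′ iff u^n − a u^(n−1) − p = 0.
  IsRoot : ℕ → ℤ → Set
  IsRoot n′ u = + p ≡ u ℤ.^ suc n′ ℤ.* (u ℤ.- + a)

  private
    instance
      p-nonTrivial : ℕ.NonTrivial p
      p-nonTrivial = prime⇒nonTrivial p-prime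
      p-nonZero : ℕ.NonZero p
      p-nonZero = prime⇒nonZero p-prime

    p+x≰1 : ∀ x → ¬ (p + x ≤ 1)
    p+x≰1 x p+x≤1 = ℕP.<⇒≱ (ℕ.nonTrivial⇒n>1 p) (ℕP.≤-trans (ℕP.m≤m+n p x) p+x≤1)

  abs-root : ∀ n′ {u} → IsRoot n′ u → p ≡ ℤ.∣ u ∣ ℕ.* (ℤ.∣ u ∣ ℕ.^ n′ ℕ.* ℤ.∣ u ℤ.- + a ∣)
  abs-root n′ {u} root = begin
    p                                                  ≡⟨ cong ℤ.∣_∣ root ⟩
    ℤ.∣ u ℤ.^ suc n′ ℤ.* (u ℤ.- + a) ∣                 ≡⟨ ℤP.abs-* (u ℤ.^ suc n′) (u ℤ.- + a) ⟩
    ℤ.∣ u ℤ.^ suc n′ ∣ ℕ.* ℤ.∣ u ℤ.- + a ∣             ≡⟨ cong (ℕ._* ℤ.∣ u ℤ.- + a ∣) (abs-^ u (suc n′)) ⟩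
    ℤ.∣ u ∣ ℕ.* ℤ.∣ u ∣ ℕ.^ n′ ℕ.* ℤ.∣ u ℤ.- + a ∣     ≡⟨ ℕP.*-assoc ℤ.∣ u ∣ _ _ ⟩
    ℤ.∣ u ∣ ℕ.* (ℤ.∣ u ∣ ℕ.^ n′ ℕ.* ℤ.∣ u ℤ.- + a ∣)   ∎
    where open ≡-Reasoning

  ∣root∣∣p : ∀ n′ {u} → IsRoot n′ u → ℤ.∣ u ∣ ∣ p
  ∣root∣∣p n′ {u} root = ℕ∣.divides rest (trans (abs-root n′ {u} root) (ℕP.*-comm ℤ.∣ u ∣ rest))
    where
    rest : ℕ
    rest = ℤ.∣ u ∣ ℕ.^ n′ ℕ.* ℤ.∣ u ℤ.- + a ∣

  unitRoot⇒exceptional : ∀ n′ {u} → IsRoot n′ u → ℤ.∣ u ∣ ≡ 1 → Exceptional (2 + n′) a p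
  unitRoot⇒exceptional n′ {u} root ∣u∣≡1 with ∣i∣≡1⇒i≡±1 {u} ∣u∣≡1 | -1^-parity n′
  ... | inj₁ refl | _ = ⊥-elim (p+x≰1 a (ℕP.≤-reflexive (ℤP.+-injective (trans (ℤP.pos-+ p a) p+a≡1))))
    where
    identity : ∀ A → + 1 ℤ.* (+ 1 ℤ.- A) ℤ.+ A ≡ + 1
    identity = solve-∀
    p+a≡1 : + p ℤ.+ + a ≡ + 1
    p+a≡1 = trans (cong (ℤ._+ + a) (trans root (cong (ℤ._* _) (ℤP.^-zeroˡ (suc n′))))) (identity (+ a))
  ... | inj₂ refl | inj₁ (2∣n′ , -1^n′≡1) =
    ℕ∣.∣m∣n⇒∣m+n (ℕ∣.∣-refl {2}) 2∣n′ , trans (ℤP.+-injective p≡1+a) (ℕP.+-comm 1 a)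
    where
    identity : ∀ A → (ℤ.- + 1 ℤ.* + 1) ℤ.* (ℤ.- + 1 ℤ.- A) ≡ + 1 ℤ.+ A
    identity = solve-∀
    p≡1+a : + p ≡ + 1 ℤ.+ + a
    p≡1+a = trans root (trans (cong (λ s → (-1ℤ ℤ.* s) ℤ.* (-1ℤ ℤ.- + a)) -1^n′≡1) (identity (+ a)))
  ... | inj₂ refl | inj₂ (_ , -1^n′≡-1) =
    ⊥-elim (p+x≰1 (1 + a) (ℕP.≤-trans (ℕP.≤-reflexive (ℤP.+-injective (trans (ℤP.pos-+ p (1 + a)) p+1+a≡0)))
                                      z≤n))
    where
    identity : ∀ A → (ℤ.- + 1 ℤ.* ℤ.- + 1) ℤ.* (ℤ.- + 1 ℤ.- A) ℤ.+ (+ 1 ℤ.+ A) ≡ + 0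
    identity = solve-∀
    p+1+a≡0 : + p ℤ.+ (+ 1 ℤ.+ + a) ≡ + 0
    p+1+a≡0 = trans (cong (ℤ._+ (+ 1 ℤ.+ + a))
                          (trans root (cong (λ s → (-1ℤ ℤ.* s) ℤ.* (-1ℤ ℤ.- + a)) -1^n′≡-1)))
                    (identity (+ a))

  primeRoot⇒exceptional : ∀ n′ {u} → IsRoot n′ u → ℤ.∣ u ∣ ≡ p → Exceptional (2 + n′) a p
  primeRoot⇒exceptional (suc m) {u} root ∣u∣≡p = contradiction (ℕP.m*n≡1⇒m≡1 p _ 1≡p*rest) ℕ.nonTrivial⇒≢1
    where
    rest : ℕ
    rest = p ℕ.^ m ℕ.* ℤ.∣ u ℤ.- + a ∣
    1≡p*rest : p ℕ.* rest ≡ 1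
    1≡p*rest = sym (ℕP.*-cancelˡ-≡ 1 (p ℕ.* rest) p (trans (ℕP.*-identityʳ p) (begin
      p                                                  ≡⟨ abs-root (suc m) {u} root ⟩
      ℤ.∣ u ∣ ℕ.* (ℤ.∣ u ∣ ℕ.* ℤ.∣ u ∣ ℕ.^ m ℕ.* ℤ.∣ u ℤ.- + a ∣)
        ≡⟨ cong (λ v → v ℕ.* (v ℕ.* v ℕ.^ m ℕ.* ℤ.∣ u ℤ.- + a ∣)) ∣u∣≡p ⟩
      p ℕ.* (p ℕ.* p ℕ.^ m ℕ.* ℤ.∣ u ℤ.- + a ∣)          ≡⟨ cong (p ℕ.*_) (ℕP.*-assoc p (p ℕ.^ m) _) ⟩
      p ℕ.* (p ℕ.* rest)                                 ∎)))
      where open ≡-Reasoning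
  primeRoot⇒exceptional zero {u} root ∣u∣≡p with ∣i∣≡n⇒i≡±n {u} ∣u∣≡p
  ... | inj₁ refl = ℕ∣.∣-refl , trans (ℤP.+-injective p≡1+a) (ℕP.+-comm 1 a)
    where
    identity : ∀ P A → (P ℤ.* + 1) ℤ.* (P ℤ.- A) ≡ P ℤ.* (P ℤ.- A)
    identity = solve-∀
    rearrange : ∀ P A → + 1 ≡ P ℤ.- A → P ≡ + 1 ℤ.+ A
    rearrange P A eq = trans (shift P A) (cong (ℤ._+ A) (sym eq))
      where
      shift : ∀ P A → P ≡ (P ℤ.- A) ℤ.+ A
      shift = solve-∀
    p≡1+a : + p ≡ + 1 ℤ.+ + a
    p≡1+a = rearrange (+ p) (+ a)
      (ℤP.*-cancelˡ-≡ (+ p) (+ 1) (+ p ℤ.- + a) (trans (ℤP.*-identityʳ (+ p)) (trans root (identity (+ p) (+ a)))))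
  ... | inj₂ refl = ⊥-elim (p+x≰1 a (ℕP.≤-reflexive (sym (ℤP.+-injective (trans 1≡p+a (ℤP.pos-+ p a))))))
    where
    identity : ∀ P A → (ℤ.- P ℤ.* + 1) ℤ.* (ℤ.- P ℤ.- A) ≡ P ℤ.* (P ℤ.+ A)
    identity = solve-∀
    1≡p+a : + 1 ≡ + p ℤ.+ + a
    1≡p+a = ℤP.*-cancelˡ-≡ (+ p) (+ 1) (+ p ℤ.+ + a)
                           (trans (ℤP.*-identityʳ (+ p)) (trans root (identity (+ p) (+ a))))

  root⇒exceptional : ∀ n′ → ∃ (IsRoot n′) → Exceptional (2 + n′) a p
  root⇒exceptional n′ (u , root) with prime⇒irreducible p-prime (∣root∣∣p n′ {u} root)
  ... | inj₁ ∣u∣≡1 = unitRoot⇒exceptional n′ {u} root ∣u∣≡1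
  ... | inj₂ ∣u∣≡p = primeRoot⇒exceptional n′ {u} root ∣u∣≡p

module FactorsOfF (n′ a p : ℕ) (p-prime : Prime p) where
  open CoefficientsOfF n′ a p
  open RootsOfF a p p-prime

  private
    instance
      p-nonTrivial : ℕ.NonTrivial p
      p-nonTrivial = prime⇒nonTrivial p-prime
      p-nonZero : ℕ.NonZero p
      p-nonZero = prime⇒nonZero p-prime

  p∤unit : ∀ {x} → ℤ.∣ x ∣ ≡ 1 → ¬ (+ p ∣ℤ x)
  p∤unit ∣x∣≡1 p∣x = ℕ.nonTrivial⇒≢1 (ℕ∣.∣1⇒≡1 (subst (p ∣_) ∣x∣≡1 (ℤ∣.∣⇒∣ᵤ p∣x)))

  p²∤F₀ : ∀ {x y} → x ℤ.* y ≡ F 0 → + p ∣ℤ x → + p ∣ℤ y → ⊥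
  p²∤F₀ {x} {y} xy≡F₀ p∣x p∣y = ℕP.<⇒≱ (ℕP.m<m*n p p (ℕ.nonTrivial⇒n>1 p)) (ℕ∣.∣⇒≤ p²∣p)
    where
    p²∣p : p ℕ.* p ∣ p
    p²∣p = subst (p ℕ.* p ∣_)
                 (trans (sym (ℤP.abs-* x y)) (trans (cong ℤ.∣_∣ (trans xy≡F₀ F-constant)) (ℤP.∣-i∣≡∣i∣ (+ p))))
                 (ℕ∣.*-pres-∣ (ℤ∣.∣⇒∣ᵤ p∣x) (ℤ∣.∣⇒∣ᵤ p∣y))

  factorDegrees : ∀ {G H} → FiniteSupport G → FiniteSupport H → conv G H ≗ F →
                  ∃₂ λ r s → HasDegree G r × HasDegree H s × r + s ≡ n × ℤ.∣ G r ∣ ≡ 1 × ℤ.∣ H s ∣ ≡ 1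
  factorDegrees {G} {H} G-finite H-finite GH≡F
    with zero⊎degree (ℤP._≟ + 0) G-finite | zero⊎degree (ℤP._≟ + 0) H-finite
  ... | inj₁ G≡0 | _ = contradiction (trans (sym (GH≡F n)) (conv-zeroˡ G H G≡0 n)) (proj₁ F-degree)
  ... | inj₂ _   | inj₁ H≡0 = contradiction (trans (sym (GH≡F n)) (conv-zeroʳ G H H≡0 n)) (proj₁ F-degree)
  ... | inj₂ (r , deg-G) | inj₂ (s , deg-H) =
    r , s , deg-G , deg-H , r+s≡n ,
    ℕP.m*n≡1⇒m≡1 ℤ.∣ G r ∣ ℤ.∣ H s ∣ ∣GrHs∣≡1 , ℕP.m*n≡1⇒n≡1 ℤ.∣ G r ∣ ℤ.∣ H s ∣ ∣GrHs∣≡1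
    where
    r+s≡n : r + s ≡ n
    r+s≡n = HasDegree-unique (HasDegree-cong GH≡F (conv-degree (ℤP.i*j≡0⇒i≡0∨j≡0 _) deg-G deg-H)) F-degree
    ∣GrHs∣≡1 : ℤ.∣ G r ∣ ℕ.* ℤ.∣ H s ∣ ≡ 1
    ∣GrHs∣≡1 = begin
      ℤ.∣ G r ∣ ℕ.* ℤ.∣ H s ∣      ≡⟨ ℤP.abs-* (G r) (H s) ⟨
      ℤ.∣ G r ℤ.* H s ∣            ≡⟨ cong ℤ.∣_∣ (conv-top (proj₂ deg-G) (proj₂ deg-H)) ⟨
      ℤ.∣ conv G H (r + s) ∣       ≡⟨ cong ℤ.∣_∣ (trans (GH≡F (r + s)) (cong F r+s≡n)) ⟩
      ℤ.∣ F n ∣                    ≡⟨ cong ℤ.∣_∣ F-top ⟩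
      1                            ∎
      where open ≡-Reasoning

  p∤H₀⇒n-1≤degree : ∀ {G H r} → FiniteSupport G → conv G H ≗ F → ¬ (+ p ∣ℤ H 0) → ¬ (+ p ∣ℤ G r) → suc n′ ≤ r
  p∤H₀⇒n-1≤degree {G} {H} {r} (L , G↑) GH≡F p∤H₀ p∤Gr
    with all⊎minimalCounterexample (λ i → + p ℤ∣.∣? G i) L (λ i L≤i → x≡0⇒q∣x (G↑ i L≤i))
  ... | inj₁ p∣G = contradiction (p∣G r) p∤Gr
  ... | inj₂ (I , p∤GI , p∣G<I) = ℕP.≤-trans n-1≤I I≤r
    where
    I≤r : I ≤ r
    I≤r = ℕP.≮⇒≥ (λ r<I → p∤Gr (p∣G<I r r<I))
    p∣GIH₀ : I < suc n′ → + p ∣ℤ G I ℤ.* H 0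
    p∣GIH₀ I<n-1 with conv-lowest-mod (+ p) G H I 0 p∣G<I (λ _ ())
    ... | e , p∣e , GH≡GIH₀+e = ℤ∣.∣m+n∣n⇒∣m (subst (+ p ∣ℤ_) GH≡GIH₀+e p∣GH) p∣e
      where
      p∣GH : + p ∣ℤ conv G H (I + 0)
      p∣GH = subst (+ p ∣ℤ_) (trans (sym (GH≡F I)) (cong (conv G H) (sym (ℕP.+-identityʳ I)))) (p∣F-low I<n-1)
    n-1≤I : suc n′ ≤ I
    n-1≤I = ℕP.≮⇒≥ (Sum.[ p∤GI , p∤H₀ ]′ ∘ euclidsLemmaℤ (G I) (H 0) p-prime ∘ p∣GIH₀)

  syntheticDivision : ∀ {G H} → conv G H ≗ F → VanishesAbove H 1 → H 1 ≡ + 1 →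
                      ∀ k → G k ≡ F (suc k) ℤ.+ (ℤ.- H 0) ℤ.* G (suc k)
  syntheticDivision {G} {H} GH≡F H↑ H₁≡1 k = begin
    G k                                                   ≡⟨ identity (H 0) (G k) (G (suc k)) ⟩
    H 0 ℤ.* G (suc k) ℤ.+ G k ℤ.+ (ℤ.- H 0) ℤ.* G (suc k)   ≡⟨ cong (ℤ._+ (ℤ.- H 0) ℤ.* G (suc k)) F[1+k] ⟨
    F (suc k) ℤ.+ (ℤ.- H 0) ℤ.* G (suc k)                   ∎
    where
    open ≡-Reasoning
    identity : ∀ h g g′ → g ≡ h ℤ.* g′ ℤ.+ g ℤ.+ (ℤ.- h) ℤ.* g′
    identity = solve-∀
    F[1+k] : F (suc k) ≡ H 0 ℤ.* G (suc k) ℤ.+ G k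
    F[1+k] = begin
      F (suc k)                                  ≡⟨ GH≡F (suc k) ⟨
      conv G H (suc k)                           ≡⟨ conv-comm G H (suc k) ⟩
      conv H G (suc k)                           ≡⟨ conv-linearˡ H G (λ i → H↑ (suc (suc i)) (s≤s (s≤s z≤n))) k ⟩
      H 0 ℤ.* G (suc k) ℤ.+ H 1 ℤ.* G k          ≡⟨ cong (λ h → H 0 ℤ.* G (suc k) ℤ.+ h ℤ.* G k) H₁≡1 ⟩
      H 0 ℤ.* G (suc k) ℤ.+ + 1 ℤ.* G k          ≡⟨ cong (λ g → H 0 ℤ.* G (suc k) ℤ.+ g) (ℤP.*-identityˡ (G k)) ⟩
      H 0 ℤ.* G (suc k) ℤ.+ G k                  ∎

  quotient-coefficients : ∀ {G} u → (∀ k → G k ≡ F (suc k) ℤ.+ u ℤ.* G (suc k)) → VanishesAbove G (suc n′) →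
                          ∀ m k → k + m ≡ n′ → G k ≡ u ℤ.^ m ℤ.* (u ℤ.- + a)
  quotient-coefficients {G} u division G↑ zero k k+0≡n′ with trans (sym (ℕP.+-identityʳ k)) k+0≡n′
  ... | refl = begin
    G n′                                         ≡⟨ division n′ ⟩
    F (suc n′) ℤ.+ u ℤ.* G (suc n′)              ≡⟨ cong₂ (λ c g → c ℤ.+ u ℤ.* g) F-subleading (division (suc n′)) ⟩
    ℤ.- + a ℤ.+ u ℤ.* (F n ℤ.+ u ℤ.* G n)        ≡⟨ cong₂ (λ c g → ℤ.- + a ℤ.+ u ℤ.* (c ℤ.+ u ℤ.* g))
                                                          F-top (G↑ n ℕP.≤-refl) ⟩
    ℤ.- + a ℤ.+ u ℤ.* (+ 1 ℤ.+ u ℤ.* + 0)        ≡⟨ identity u (+ a) ⟩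
    + 1 ℤ.* (u ℤ.- + a)                          ∎
    where
    open ≡-Reasoning
    identity : ∀ u A → ℤ.- A ℤ.+ u ℤ.* (+ 1 ℤ.+ u ℤ.* + 0) ≡ + 1 ℤ.* (u ℤ.- A)
    identity = solve-∀
  quotient-coefficients {G} u division G↑ (suc m) k k+1+m≡n′ = begin
    G k                                          ≡⟨ division k ⟩
    F (suc k) ℤ.+ u ℤ.* G (suc k)                ≡⟨ cong₂ (λ c g → c ℤ.+ u ℤ.* g) (F-middle 1+k<1+n′)
                                                          (quotient-coefficients u division G↑ m (suc k) 1+k+m≡n′) ⟩
    + 0 ℤ.+ u ℤ.* (u ℤ.^ m ℤ.* (u ℤ.- + a))      ≡⟨ ℤP.+-identityˡ _ ⟩
    u ℤ.* (u ℤ.^ m ℤ.* (u ℤ.- + a))              ≡⟨ ℤP.*-assoc u (u ℤ.^ m) _ ⟨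
    u ℤ.^ suc m ℤ.* (u ℤ.- + a)                  ∎
    where
    open ≡-Reasoning
    1+k+m≡n′ : suc k + m ≡ n′
    1+k+m≡n′ = trans (sym (ℕP.+-suc k m)) k+1+m≡n′
    1+k<1+n′ : suc k < suc n′
    1+k<1+n′ = s≤s (subst (suc k ≤_) 1+k+m≡n′ (ℕP.m≤m+n (suc k) m))

  monicLinearFactor⇒root : ∀ {G H} → conv G H ≗ F → VanishesAbove G (suc n′) → VanishesAbove H 1 → H 1 ≡ + 1 →
                           IsRoot n′ (ℤ.- H 0)
  monicLinearFactor⇒root {G} {H} GH≡F G↑ H↑ H₁≡1 = begin
    + p                                   ≡⟨ trans (sym (ℤP.neg-involutive (+ p))) (cong ℤ.-_ (sym F-constant)) ⟩
    ℤ.- F 0                               ≡⟨ cong ℤ.-_ (GH≡F 0) ⟨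
    ℤ.- (G 0 ℤ.* H 0)                     ≡⟨ neg-swap (G 0) (H 0) ⟩
    u ℤ.* G 0                             ≡⟨ cong (u ℤ.*_) (quotient-coefficients u division G↑ n′ 0 refl) ⟩
    u ℤ.* (u ℤ.^ n′ ℤ.* (u ℤ.- + a))      ≡⟨ ℤP.*-assoc u (u ℤ.^ n′) _ ⟨
    u ℤ.^ suc n′ ℤ.* (u ℤ.- + a)          ∎
    where
    open ≡-Reasoning
    u : ℤ
    u = ℤ.- H 0
    division : ∀ k → G k ≡ F (suc k) ℤ.+ u ℤ.* G (suc k)
    division = syntheticDivision GH≡F H↑ H₁≡1
    neg-swap : ∀ g h → ℤ.- (g ℤ.* h) ≡ (ℤ.- h) ℤ.* g
    neg-swap = solve-∀

  linearFactor⇒root : ∀ {G H} → conv G H ≗ F → VanishesAbove G (suc n′) → VanishesAbove H 1 → ℤ.∣ H 1 ∣ ≡ 1 →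
                      ∃ (IsRoot n′)
  linearFactor⇒root {G} {H} GH≡F G↑ H↑ ∣H₁∣≡1 with ∣i∣≡1⇒i≡±1 {H 1} ∣H₁∣≡1
  ... | inj₁ H₁≡1  = ℤ.- H 0 , monicLinearFactor⇒root GH≡F G↑ H↑ H₁≡1
  ... | inj₂ H₁≡-1 =
    ℤ.- H′ 0 , monicLinearFactor⇒root {G′} {H′} G′H′≡F (λ i → cong -1* ∘ G↑ i) (λ i → cong -1* ∘ H↑ i) (cong -1* H₁≡-1)
    where
    -1* : ℤ → ℤ
    -1* = -1ℤ ℤ.*_
    G′ H′ : ℕ → ℤ
    G′ = -1* ∘ G
    H′ = -1* ∘ H
    G′H′≡F : conv G′ H′ ≗ F
    G′H′≡F k = begin
      conv G′ H′ k                       ≡⟨ conv-scaleˡ -1ℤ G H′ k ⟩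
      -1ℤ ℤ.* conv G H′ k                ≡⟨ cong -1* (conv-scaleʳ -1ℤ G H k) ⟩
      -1ℤ ℤ.* (-1ℤ ℤ.* conv G H k)       ≡⟨ ℤP.*-assoc -1ℤ -1ℤ _ ⟨
      + 1 ℤ.* conv G H k                 ≡⟨ ℤP.*-identityˡ _ ⟩
      conv G H k                         ≡⟨ GH≡F k ⟩
      F k                                ∎
      where open ≡-Reasoning

  cofactorDegree : ∀ r s → r + s ≡ n → suc n′ ≤ r → s ≡ 0 ⊎ (s ≡ 1 × r ≡ suc n′)
  cofactorDegree r zero          _     _       = inj₁ refl
  cofactorDegree r (suc zero)    r+1≡n _       = inj₂ (refl , ℕP.suc-injective (trans (ℕP.+-comm 1 r) r+1≡n))
  cofactorDegree r (suc (suc s)) r+2+s≡n n-1≤r = contradiction (subst (r ≤_) r+s≡n′ (ℕP.m≤m+n r s)) (ℕP.<⇒≱ n-1≤r)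
    where
    r+s≡n′ : r + s ≡ n′
    r+s≡n′ = ℕP.suc-injective (ℕP.suc-injective
               (trans (sym (trans (ℕP.+-suc r (suc s)) (cong suc (ℕP.+-suc r s)))) r+2+s≡n))

  p∤H₀⇒constant⊎exceptional : ∀ {G H} → FiniteSupport G → FiniteSupport H → conv G H ≗ F → ¬ (+ p ∣ℤ H 0) →
                              HasDegree H 0 ⊎ Exceptional n a p
  p∤H₀⇒constant⊎exceptional G-finite H-finite GH≡F p∤H₀
    with factorDegrees G-finite H-finite GH≡F
  ... | r , s , deg-G , deg-H , r+s≡n , ∣Gr∣≡1 , ∣Hs∣≡1
    with cofactorDegree r s r+s≡n (p∤H₀⇒n-1≤degree G-finite GH≡F p∤H₀ (p∤unit ∣Gr∣≡1))
  ... | inj₁ refl          = inj₁ deg-H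
  ... | inj₂ (refl , refl) =
    inj₂ (root⇒exceptional n′ (linearFactor⇒root GH≡F (proj₂ deg-G) (proj₂ deg-H) ∣Hs∣≡1))

  constant⊎exceptional : ∀ {G H} → FiniteSupport G → FiniteSupport H → conv G H ≗ F →
                         HasDegree G 0 ⊎ HasDegree H 0 ⊎ Exceptional n a p
  constant⊎exceptional {G} {H} G-finite H-finite GH≡F with + p ℤ∣.∣? H 0
  ... | no p∤H₀  = inj₂ (p∤H₀⇒constant⊎exceptional G-finite H-finite GH≡F p∤H₀)
  ... | yes p∣H₀ = Sum.map₂ inj₂ (p∤H₀⇒constant⊎exceptional H-finite G-finite HG≡F p∤G₀)
    where
    HG≡F : conv H G ≗ F
    HG≡F k = trans (conv-comm H G k) (GH≡F k)
    p∤G₀ : ¬ (+ p ∣ℤ G 0)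
    p∤G₀ p∣G₀ = p²∤F₀ (GH≡F 0) p∣G₀ p∣H₀

coeffℤ : List ℤ → ℕ → ℤ
coeffℤ []       _       = + 0
coeffℤ (c ∷ cs) zero    = c
coeffℤ (c ∷ cs) (suc i) = coeffℤ cs i

coeff-map-ι : ∀ cs k → coeff (map ι cs) k ≡ ι (coeffℤ cs k)
coeff-map-ι []       k       = refl
coeff-map-ι (c ∷ cs) zero    = refl
coeff-map-ι (c ∷ cs) (suc k) = coeff-map-ι cs k

alternating : ℕ → ℤ → List ℤ
alternating zero    P = []
alternating (suc m) P = ℤ.- P ∷ P ∷ alternating m P

-- The quotient of f_{2m+2, a, P−1} by 1 + x: −P + P x − P x² + ⋯ − P x^(2m) + x^(2m+1).
cofactor : ℕ → ℤ → List ℤ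
cofactor m P = alternating m P ++ (ℤ.- P ∷ + 1 ∷ [])

cofactor-constant : ∀ m P → coeffℤ (cofactor m P) 0 ≡ ℤ.- P
cofactor-constant zero    P = refl
cofactor-constant (suc m) P = refl

cofactor-top : ∀ m P → coeffℤ (cofactor m P) (suc (m ℕ.* 2)) ≡ + 1
cofactor-top zero    P = refl
cofactor-top (suc m) P = cofactor-top m P

cofactor-adjacent : ∀ a m k → coeffℤ (cofactor m (+ (a + 1))) (suc k) ℤ.+ coeffℤ (cofactor m (+ (a + 1))) k
                              ≡ δ (suc (m ℕ.* 2)) k ℤ.- + a ℤ.* δ (m ℕ.* 2) k
cofactor-adjacent a zero zero = trans (cong (λ P → + 1 ℤ.+ ℤ.- P) (ℤP.pos-+ a 1)) (identity (+ a))
  where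
  identity : ∀ A → + 1 ℤ.+ ℤ.- (A ℤ.+ + 1) ≡ + 0 ℤ.- A ℤ.* + 1
  identity = solve-∀
cofactor-adjacent a zero (suc zero) = identity (+ a)
  where
  identity : ∀ A → + 0 ℤ.+ + 1 ≡ + 1 ℤ.- A ℤ.* + 0
  identity = solve-∀
cofactor-adjacent a zero (suc (suc k)) = identity (+ a)
  where
  identity : ∀ A → + 0 ℤ.+ + 0 ≡ + 0 ℤ.- A ℤ.* + 0
  identity = solve-∀
cofactor-adjacent a (suc m) zero = identity (+ a) (+ (a + 1))
  where
  identity : ∀ A P → P ℤ.+ ℤ.- P ≡ + 0 ℤ.- A ℤ.* + 0
  identity = solve-∀
cofactor-adjacent a (suc m) (suc zero) rewrite cofactor-constant m (+ (a + 1)) = identity (+ a) (+ (a + 1))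
  where
  identity : ∀ A P → ℤ.- P ℤ.+ P ≡ + 0 ℤ.- A ℤ.* + 0
  identity = solve-∀
cofactor-adjacent a (suc m) (suc (suc k)) = cofactor-adjacent a m k

exceptional-factorisation : ∀ m a →
                            fPoly (suc m ℕ.* 2) a (a + 1) ≈ₚ (1ℚ ∷ 1ℚ ∷ []) *ₚ map ι (cofactor m (+ (a + 1)))
exceptional-factorisation m a zero = begin
  coeff (fPoly n a (a + 1)) 0                ≡⟨ coeff-fPoly n a (a + 1) 0 ⟩
  ι (fCoeff n a (a + 1) 0)                   ≡⟨ cong ι (CoefficientsOfF.F-constant (m ℕ.* 2) a (a + 1)) ⟩
  ι (ℤ.- + (a + 1))                          ≡⟨ cong ι (cofactor-constant m (+ (a + 1))) ⟨
  ι (coeffℤ q 0)                             ≡⟨ coeff-map-ι q 0 ⟨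
  coeff (map ι q) 0                          ≡⟨ ℚP.*-identityˡ (coeff (map ι q) 0) ⟨
  1ℚ ℚ.* coeff (map ι q) 0                   ≡⟨ coeff-* (1ℚ ∷ 1ℚ ∷ []) (map ι q) 0 ⟨
  coeff ((1ℚ ∷ 1ℚ ∷ []) *ₚ map ι q) 0        ∎
  where
  open ≡-Reasoning
  n : ℕ
  n = suc m ℕ.* 2
  q : List ℤ
  q = cofactor m (+ (a + 1))
exceptional-factorisation m a (suc k) = begin
  coeff (fPoly n a (a + 1)) (suc k)                               ≡⟨ coeff-fPoly n a (a + 1) (suc k) ⟩
  ι (fCoeff n a (a + 1) (suc k))
    ≡⟨ cong ι (no-constant-term (δ (suc (m ℕ.* 2)) k) (+ a) (δ (m ℕ.* 2) k) (+ (a + 1))) ⟩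
  ι (δ (suc (m ℕ.* 2)) k ℤ.- + a ℤ.* δ (m ℕ.* 2) k)               ≡⟨ cong ι (cofactor-adjacent a m k) ⟨
  ι (coeffℤ q (suc k) ℤ.+ coeffℤ q k)                             ≡⟨ ι-homo-+ (coeffℤ q (suc k)) (coeffℤ q k) ⟩
  ι (coeffℤ q (suc k)) ℚ.+ ι (coeffℤ q k)
    ≡⟨ cong₂ ℚ._+_ (coeff-map-ι q (suc k)) (coeff-map-ι q k) ⟨
  coeff (map ι q) (suc k) ℚ.+ coeff (map ι q) k
    ≡⟨ cong₂ ℚ._+_ (ℚP.*-identityˡ (coeff (map ι q) (suc k))) (ℚP.*-identityˡ (coeff (map ι q) k)) ⟨
  1ℚ ℚ.* coeff (map ι q) (suc k) ℚ.+ 1ℚ ℚ.* coeff (map ι q) k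
    ≡⟨ ℚ-conv.conv-linearˡ (coeff (1ℚ ∷ 1ℚ ∷ [])) (coeff (map ι q)) (λ _ → refl) k ⟨
  ℚ-conv.conv (coeff (1ℚ ∷ 1ℚ ∷ [])) (coeff (map ι q)) (suc k)    ≡⟨ coeff-* (1ℚ ∷ 1ℚ ∷ []) (map ι q) (suc k) ⟨
  coeff ((1ℚ ∷ 1ℚ ∷ []) *ₚ map ι q) (suc k)                       ∎
  where
  open ≡-Reasoning
  n : ℕ
  n = suc m ℕ.* 2
  q : List ℤ
  q = cofactor m (+ (a + 1))
  no-constant-term : ∀ X A Y P → X ℤ.- A ℤ.* Y ℤ.- P ℤ.* + 0 ≡ X ℤ.- A ℤ.* Y
  no-constant-term = solve-∀

exceptional⇒reducible : ∀ {n′ a p} → Exceptional (2 + n′) a p → ¬ Irreducible (fPoly (2 + n′) a p)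
exceptional⇒reducible {a = a} (ℕ∣.divides (suc m) refl , refl) (_ , split) =
  Sum.[ nonconstant⇒nonunit (1ℚ ∷ 1ℚ ∷ []) 0 (λ ()) , nonconstant⇒nonunit (map ι q) (m ℕ.* 2) q-top≢0 ]′
    (split (1ℚ ∷ 1ℚ ∷ []) (map ι q) (exceptional-factorisation m a))
  where
  q : List ℤ
  q = cofactor m (+ (a + 1))
  q-top≢0 : coeff (map ι q) (suc (m ℕ.* 2)) ≢ 0ℚ
  q-top≢0 eq = ℚP.1≢0 (trans (sym (trans (coeff-map-ι q _) (cong ι (cofactor-top m (+ (a + 1)))))) eq)

sameZeros⇒sameDegree : ∀ {G} g {r} → (∀ i → G i ≡ + 0 ⇔ coeff g i ≡ 0ℚ) →
                       ℤ-conv.HasDegree G r → ℚ-conv.HasDegree (coeff g) r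
sameZeros⇒sameDegree g {r} G≡0⇔g≡0 (Gr≢0 , G↑) =
  Gr≢0 ∘ Equivalence.from (G≡0⇔g≡0 r) , λ i r<i → Equivalence.to (G≡0⇔g≡0 i) (G↑ i r<i)

ℚ-factor-constant⊎exceptional : ∀ n′ a p {g h} → Prime p → fPoly (2 + n′) a p ≈ₚ g *ₚ h →
                                ℚ-conv.HasDegree (coeff g) 0 ⊎ ℚ-conv.HasDegree (coeff h) 0 ⊎ Exceptional (2 + n′) a p
ℚ-factor-constant⊎exceptional n′ a p {g} {h} p-prime f≈gh =
  Sum.map (sameZeros⇒sameDegree g G≡0⇔g≡0) (Sum.map₁ (sameZeros⇒sameDegree h H≡0⇔h≡0))
          (FactorsOfF.constant⊎exceptional n′ a p p-prime G-finite H-finite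
                                           (λ k → trans (GH≡DF k) (ℤP.*-identityˡ _)))
  where
  D≢0 : denominator g ℕ.* denominator h ≢ 0
  D≢0 = Sum.[ denominator≢0 g , denominator≢0 h ]′ ∘ ℕP.m*n≡0⇒m≡0∨n≡0 (denominator g)
  cleared : IntegralFactorisation (denominator g ℕ.* denominator h) (fCoeff (2 + n′) a p) g h
  cleared = clearDenominators {fPoly (2 + n′) a p} {fCoeff (2 + n′) a p} g h (coeff-fPoly (2 + n′) a p) f≈gh
  open IntegralFactorisation (gaussLemma D≢0 cleared)

nonexceptional⇒irreducible : ∀ n′ a p → Prime p → ¬ Exceptional (2 + n′) a p → Irreducible (fPoly (2 + n′) a p)
nonexceptional⇒irreducible n′ a p p-prime ¬exceptional = f-nonunit , λ g h f≈gh →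
  Sum.[ inj₁ ∘ nonzeroConstant⇒unit g , Sum.[ inj₂ ∘ nonzeroConstant⇒unit h , ⊥-elim ∘ ¬exceptional ]′ ]′
    (ℚ-factor-constant⊎exceptional n′ a p {g} {h} p-prime f≈gh)
  where
  open CoefficientsOfF n′ a p using (n; F-top)
  f-nonunit : ¬ IsUnit (fPoly n a p)
  f-nonunit = nonconstant⇒nonunit (fPoly n a p) (suc n′)
                (λ eq → ℚP.1≢0 (trans (sym (trans (coeff-fPoly n a p n) (cong ι F-top))) eq))

lemma3p1 : (a n p : ℕ) → 1 ≤ a → 2 ≤ n → Prime p →
           Irreducible (fPoly n a p) ⇔ (¬ (2 ∣ n × p ≡ a + 1))
lemma3p1 a (suc (suc n′)) p _ (s≤s (s≤s z≤n)) p-prime =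
  mk⇔ (λ irreducible exceptional → exceptional⇒reducible exceptional irreducible)
      (nonexceptional⇒irreducible n′ a p p-prime)
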